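{- Let $n\ge 3$, $2\le l\le n-1$, $h\ge 1$, and let $H_n^4$ be any graph in $\mathscr{H}_n^4$ (with a recursive construction and induced labeling). If $F$ is a minimum $h$-extra edge-cut of $H_n^4$, or a minimum $\mathscr{P}_i^l$-conditional edge-cut of $H_n^4$ for some $i\in\{1,\dots,5\}$, then $H_n^4-F$ has exactly two components.
   Context: The family $\mathscr{H}_n^4$ ($n\ge 2$): $\mathscr{H}_2^4=\{K_4\}$; for $n\ge 3$, a graph is in $\mathscr{H}_n^4$ iff (up to isomorphism) it is obtained from two vertex-disjoint graphs $G_0,G_1\in\mathscr{H}_{n-1}^4$ by adding an arbitrary perfect matching between them. Labeling: the vertices of $K_4$ get labels $00,01,10,11$ bijectively; if $H_n^4$ is built from $G_0,G_1$, a vertex of $G_b$ with label $w$ gets label $bw$. An $l$-dimensional subnetwork is the subgraph induced by all vertices whose labels share a fixed prefix of length $n-l$. An $h$-extra edge-cut of $G$ is $F\subseteq E(G)$ with $G-F$ disconnected and every component having at least $h$ vertices. For a property $\mathscr{P}$, a $\mathscr{P}$-conditional edge-cut is $F\subseteq E(G)$ with $G-F$ disconnected and every component having $\mathscr{P}$; "minimum" means of minimum cardinality. Properties: $\mathscr{P}_1^l$: minimum degree at least $l$; $\mathscr{P}_2^l$: average degree at least $l$; $\mathscr{P}_3^l$: at least $2^l$ vertices; $\mathscr{P}_4^l$: every vertex lies in an $l$-dimensional subnetwork none of whose edges is in $F$; $\mathscr{P}_5^l$ (cyclic): $G-F$ has at least two components containing a cycle (a cyclic edge-cut). -}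

module Defs where

open import Data.Nat using (ℕ; zero; suc; _≤_; _*_; _∸_; _^_)
open import Data.Bool using (Bool; true; false)
open import Data.Vec using (Vec; []; _∷_)
open import Data.List using (List; []; _∷_; length; _++_; [_])
open import Data.List.Membership.Propositional using (_∈_)
open import Data.List.Relation.Unary.All using (All)
open import Data.List.Relation.Unary.AllPairs using (AllPairs)
open import Data.List.Relation.Unary.Unique.Propositional using (Unique)
open import Data.List.Relation.Unary.Linked using (Linked)
open import Data.Product using (Σ; _×_; _,_; proj₁; proj₂; ∃; ∃-syntax)
open import Data.Sum using (_⊎_)
open import Data.Unit using (⊤)
open import Function.Bundles using (_↔_; Inverse)
open import Relation.Binary.PropositionalEquality using (_≡_)
open import Relation.Binary.Construct.Closure.ReflexiveTransitive using (Star)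
open import Relation.Nullary using (¬_)

-- Vertices: labels = bit strings of length n (most significant bit first)

V : ℕ → Set
V n = Vec Bool n

-- A recursive construction of a graph in 𝓗ₙ⁴ (with its induced labeling).
--   K4   : K_4 on the labels 00,01,10,11
--   join G₀ G₁ π : vertices 0w (from G₀) and 1w (from G₁), plus the perfect
--          matching {0w , 1(π w)} given by the bijection π.
data H4 : ℕ → Set where
  K4   : H4 2
  join : ∀ {n} → H4 n → H4 n → (V n ↔ V n) → H4 (suc n)

Adj : ∀ {n} → H4 n → V n → V n → Set
Adj K4 u v = ¬ (u ≡ v)
Adj (join G₀ G₁ π) (false ∷ u) (false ∷ v) = Adj G₀ u v
Adj (join G₀ G₁ π) (true  ∷ u) (true  ∷ v) = Adj G₁ u v
Adj (join G₀ G₁ π) (false ∷ u) (true  ∷ v) = Inverse.to π u ≡ v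
Adj (join G₀ G₁ π) (true  ∷ u) (false ∷ v) = Inverse.to π v ≡ u

-- Edge sets: a list of edges (each given as an ordered pair of endpoints),
-- containing no unordered edge twice.  |F| = length F.

EdgeList : ℕ → Set
EdgeList n = List (V n × V n)

SameEdge : ∀ {n} → V n × V n → V n × V n → Set
SameEdge (u , v) (u' , v') = (u ≡ u' × v ≡ v') ⊎ (u ≡ v' × v ≡ u')

IsEdgeSet : ∀ {n} → H4 n → EdgeList n → Set
IsEdgeSet G F = All (λ e → Adj G (proj₁ e) (proj₂ e)) F
              × AllPairs (λ e e' → ¬ SameEdge e e') F

InF : ∀ {n} → EdgeList n → V n → V n → Set
InF F u v = (u , v) ∈ F ⊎ (v , u) ∈ F

AdjF : ∀ {n} → H4 n → EdgeList n → V n → V n → Set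
AdjF G F u v = Adj G u v × ¬ InF F u v

Conn : ∀ {n} → H4 n → EdgeList n → V n → V n → Set
Conn G F = Star (AdjF G F)

Disconnected : ∀ {n} → H4 n → EdgeList n → Set
Disconnected G F = ∃[ u ] ∃[ v ] ¬ Conn G F u v

ExactlyTwoComponents : ∀ {n} → H4 n → EdgeList n → Set
ExactlyTwoComponents G F =
  ∃[ a ] ∃[ b ] (¬ Conn G F a b × (∀ u → Conn G F a u ⊎ Conn G F b u))

CompAtLeast : ∀ {n} → H4 n → EdgeList n → V n → ℕ → Set
CompAtLeast G F r k =
  ∃[ xs ] (Unique xs × All (Conn G F r) xs × k ≤ length xs)

CompMinDeg : ∀ {n} → H4 n → EdgeList n → V n → ℕ → Set
CompMinDeg G F r l =
  ∀ u → Conn G F r u →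
    ∃[ ys ] (Unique ys × All (AdjF G F u) ys × l ≤ length ys)

-- 𝓟₂ˡ : average degree at least l, i.e. 2|E(C)| / |V(C)| ≥ l,
-- where xs lists exactly the vertices and es exactly the edges of C.
CompAvgDeg : ∀ {n} → H4 n → EdgeList n → V n → ℕ → Set
CompAvgDeg G F r l =
  ∃[ xs ] ∃[ es ]
    ( (Unique xs × (∀ u → Conn G F r u → u ∈ xs) × All (Conn G F r) xs)
    × ( All (λ e → AdjF G F (proj₁ e) (proj₂ e) × Conn G F r (proj₁ e)) es
      × AllPairs (λ e e' → ¬ SameEdge e e') es
      × (∀ a b → Conn G F r a → AdjF G F a b → InF es a b))
    × l * length xs ≤ 2 * length es )

SamePrefix : ∀ {n} → ℕ → V n → V n → Set
SamePrefix zero    u        v        = ⊤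
SamePrefix (suc k) []       []       = ⊤
SamePrefix (suc k) (x ∷ u) (y ∷ v) = x ≡ y × SamePrefix k u v

-- 𝓟₄ˡ : every vertex u of the component lies in an l-dimensional subnetwork
-- (vertices sharing u's prefix of length n-l) none of whose edges is in F
CompSubnet : ∀ {n} → H4 n → EdgeList n → V n → ℕ → Set
CompSubnet {n} G F r l =
  ∀ u → Conn G F r u →
    ∀ e → e ∈ F →
      ¬ (SamePrefix (n ∸ l) (proj₁ e) u × SamePrefix (n ∸ l) (proj₂ e) u)

CompHasCycle : ∀ {n} → H4 n → EdgeList n → V n → Set
CompHasCycle G F r =
  ∃[ v ] ∃[ vs ]
    ( 2 ≤ length vs × Unique (v ∷ vs) × All (Conn G F r) (v ∷ vs)
    × Linked (AdjF G F) (v ∷ vs ++ [ v ]) )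

ExtraCut : ∀ {n} → ℕ → H4 n → EdgeList n → Set
ExtraCut h G F =
  IsEdgeSet G F × Disconnected G F × (∀ r → CompAtLeast G F r h)

data Property : Set where
  𝓟₁ 𝓟₂ 𝓟₃ 𝓟₄ 𝓟₅ : Property

CondCut : ∀ {n} → Property → ℕ → H4 n → EdgeList n → Set
CondCut 𝓟₁ l G F = IsEdgeSet G F × Disconnected G F × (∀ r → CompMinDeg G F r l)
CondCut 𝓟₂ l G F = IsEdgeSet G F × Disconnected G F × (∀ r → CompAvgDeg G F r l)
CondCut 𝓟₃ l G F = IsEdgeSet G F × Disconnected G F × (∀ r → CompAtLeast G F r (2 ^ l))
CondCut 𝓟₄ l G F = IsEdgeSet G F × Disconnected G F × (∀ r → CompSubnet G F r l)
-- cyclic edge-cut: G - F has at least two (distinct) components with a cycle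
CondCut 𝓟₅ l G F = IsEdgeSet G F × Disconnected G F ×
  ∃[ a ] ∃[ b ] (¬ Conn G F a b × CompHasCycle G F a × CompHasCycle G F b)

IsMinimum : ∀ {n} → (EdgeList n → Set) → EdgeList n → Set
IsMinimum {n} Cut F = Cut F × (∀ (F' : EdgeList n) → Cut F' → length F ≤ length F')

-- Every graph of 𝓗ₙ⁴ is connected.  Suppose G − F had a component other than
-- those of the two separated vertices a and b (for a cyclic cut: of two cyclic
-- components).  Walking in G from that component to a, we leave it along an
-- edge {p, q} ∈ F that joins two different components of G − F.  Putting the
-- edge back merges exactly these two components, so a and b stay separated, and
-- every component property of the theorem survives: size, minimum degree, the
-- subnetwork condition and cycles are monotone, and the merged component has
-- the vertices and edges of both parts plus {p, q}, so l|V| ≤ 2|E| adds up.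
-- F minus {p, q} is then a smaller cut of the same kind.
module Submission where

open import Defs
open import Data.Nat using (ℕ; suc; _≤_; _<_; _+_; _*_)
open import Data.Nat.Properties using (*-distribˡ-+; +-mono-≤; +-monoʳ-≤; *-monoʳ-≤; m≤m+n; n≮n; module ≤-Reasoning)
open import Data.Bool using (true; false)
import Data.Bool.Properties as Bool
open import Data.Vec using ([]; _∷_)
open import Data.Vec.Properties using (≡-dec)
open import Data.List using (List; []; _∷_; length; _++_; [_]; map)
open import Data.List.Properties using (length-++; length-removeAt′)
open import Data.List.Membership.Propositional using (_∈_)
open import Data.List.Membership.DecPropositional using (_∈?_)
open import Data.List.Membership.Propositional.Properties using (∈-++⁺ˡ; ∈-++⁺ʳ; ∈-map⁺)
open import Data.List.Relation.Unary.Any using (here; there; index; _─_)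
open import Data.List.Relation.Unary.All using (All; []; _∷_)
import Data.List.Relation.Unary.All as All
import Data.List.Relation.Unary.All.Properties as All
open import Data.List.Relation.Unary.AllPairs using (AllPairs; []; _∷_)
import Data.List.Relation.Unary.AllPairs.Properties as AllPairs
import Data.List.Relation.Unary.Unique.Propositional.Properties as Unique
import Data.List.Relation.Unary.Linked as Linked
open import Data.Product using (Σ; _×_; _,_; proj₁; proj₂; ∃-syntax)
open import Data.Product.Properties using () renaming (≡-dec to ×-≡-dec)
open import Data.Sum using (_⊎_; inj₁; inj₂; swap)
open import Data.Empty using (⊥; ⊥-elim)
open import Function.Bundles using (Inverse)
open import Level using (0ℓ)
open import Relation.Binary.Core using (Rel)
open import Relation.Binary.Definitions using (DecidableEquality; Decidable; Symmetric)
open import Relation.Binary.PropositionalEquality using (_≡_; refl; sym; trans; subst)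
open import Relation.Binary.Construct.Closure.ReflexiveTransitive
  using (Star; ε; _◅_; _◅◅_; gmap; reverse)
import Relation.Binary.Construct.Closure.ReflexiveTransitive as Star
open import Relation.Nullary using (¬_; Dec; yes; no)
open import Relation.Nullary.Decidable using (_×-dec_; _⊎-dec_; ¬?; map′)

module _ {A : Set} {x : A} where

  ∈-─⁻ : ∀ {xs} (x∈xs : x ∈ xs) {y} → y ∈ (xs ─ x∈xs) → y ∈ xs
  ∈-─⁻ (here _)     y∈         = there y∈
  ∈-─⁻ (there _)    (here y≡)  = here y≡
  ∈-─⁻ (there x∈xs) (there y∈) = there (∈-─⁻ x∈xs y∈)

  ∈-─-cases : ∀ {xs} (x∈xs : x ∈ xs) {y} → y ∈ xs → y ≡ x ⊎ y ∈ (xs ─ x∈xs)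
  ∈-─-cases (here x≡)    (here y≡)  = inj₁ (trans y≡ (sym x≡))
  ∈-─-cases (here _)     (there y∈) = inj₂ y∈
  ∈-─-cases (there _)    (here y≡)  = inj₂ (here y≡)
  ∈-─-cases (there x∈xs) (there y∈) with ∈-─-cases x∈xs y∈
  ... | inj₁ y≡x = inj₁ y≡x
  ... | inj₂ y∈′ = inj₂ (there y∈′)

  AllPairs-─⁺ : ∀ {R : Rel A 0ℓ} {xs} (x∈xs : x ∈ xs) → AllPairs R xs → AllPairs R (xs ─ x∈xs)
  AllPairs-─⁺ (here _)     (_ ∷ rs) = rs
  AllPairs-─⁺ (there x∈xs) (r ∷ rs) = All.─⁺ x∈xs r ∷ AllPairs-─⁺ x∈xs rs

  AllPairs-─-removed : ∀ {R : Rel A 0ℓ} {xs} (x∈xs : x ∈ xs) → AllPairs R xs →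
                       ∀ {y} → y ∈ (xs ─ x∈xs) → R x y ⊎ R y x
  AllPairs-─-removed (here refl)  (r ∷ _)  y∈          = inj₁ (All.lookup r y∈)
  AllPairs-─-removed (there x∈xs) (r ∷ _)  (here refl) = inj₂ (All.lookup r x∈xs)
  AllPairs-─-removed (there x∈xs) (_ ∷ rs) (there y∈) = AllPairs-─-removed x∈xs rs y∈

-- Floyd–Warshall: Via S x y says that some path from x to y has all its inner
-- vertices in S; adding the vertices of S one at a time keeps it decidable.
module Reachability {X : Set} (_≟_ : DecidableEquality X) {R : Rel X 0ℓ} (R? : Decidable R)
                    (vertices : List X) (∈-vertices : ∀ x → x ∈ vertices) where

  Via : List X → Rel X 0ℓ
  Via []      x y = x ≡ y ⊎ R x y
  Via (v ∷ S) x y = Via S x y ⊎ (Via S x v × Via S v y)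

  Via? : ∀ S → Decidable (Via S)
  Via? []      x y = (x ≟ y) ⊎-dec R? x y
  Via? (v ∷ S) x y = Via? S x y ⊎-dec (Via? S x v ×-dec Via? S v y)

  Via-direct : ∀ S {x y} → x ≡ y ⊎ R x y → Via S x y
  Via-direct []      x~y = x~y
  Via-direct (v ∷ S) x~y = inj₁ (Via-direct S x~y)

  Via⇒Star : ∀ S {x y} → Via S x y → Star R x y
  Via⇒Star []      (inj₁ refl)      = ε
  Via⇒Star []      (inj₂ xRy)       = xRy ◅ ε
  Via⇒Star (v ∷ S) (inj₁ xy)        = Via⇒Star S xy
  Via⇒Star (v ∷ S) (inj₂ (xv , vy)) = Via⇒Star S xv ◅◅ Via⇒Star S vy

  Via-◅ : ∀ S {x z y} → R x z → z ∈ S → Via S z y → Via S x y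
  Via-◅ (v ∷ S) xRz (here refl) (inj₁ zy)        = inj₂ (Via-direct S (inj₂ xRz) , zy)
  Via-◅ (v ∷ S) xRz (here refl) (inj₂ (_ , zy))  = inj₂ (Via-direct S (inj₂ xRz) , zy)
  Via-◅ (v ∷ S) xRz (there z∈)  (inj₁ zy)        = inj₁ (Via-◅ S xRz z∈ zy)
  Via-◅ (v ∷ S) xRz (there z∈)  (inj₂ (zv , vy)) = inj₂ (Via-◅ S xRz z∈ zv , vy)

  Star⇒Via : ∀ {x y} → Star R x y → Via vertices x y
  Star⇒Via ε          = Via-direct vertices (inj₁ refl)
  Star⇒Via (xRz ◅ zy) = Via-◅ vertices xRz (∈-vertices _) (Star⇒Via zy)

  Star? : Decidable (Star R)
  Star? x y = map′ (Via⇒Star vertices) Star⇒Via (Via? vertices x y)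

_≟V_ : ∀ {n} → DecidableEquality (V n)
_≟V_ = ≡-dec Bool._≟_

allV : ∀ n → List (V n)
allV 0       = [] ∷ []
allV (suc n) = map (false ∷_) (allV n) ++ map (true ∷_) (allV n)

∈-allV : ∀ {n} (v : V n) → v ∈ allV n
∈-allV []                  = here refl
∈-allV {suc n} (false ∷ v) = ∈-++⁺ˡ (∈-map⁺ (false ∷_) (∈-allV v))
∈-allV {suc n} (true ∷ v)  = ∈-++⁺ʳ (map (false ∷_) (allV n)) (∈-map⁺ (true ∷_) (∈-allV v))

Adj? : ∀ {n} (G : H4 n) → Decidable (Adj G)
Adj? K4 u v = ¬? (u ≟V v)
Adj? (join G₀ G₁ π) (false ∷ u) (false ∷ v) = Adj? G₀ u v
Adj? (join G₀ G₁ π) (true  ∷ u) (true  ∷ v) = Adj? G₁ u v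
Adj? (join G₀ G₁ π) (false ∷ u) (true  ∷ v) = Inverse.to π u ≟V v
Adj? (join G₀ G₁ π) (true  ∷ u) (false ∷ v) = Inverse.to π v ≟V u

Adj-sym : ∀ {n} (G : H4 n) → Symmetric (Adj G)
Adj-sym K4 u≢v v≡u = u≢v (sym v≡u)
Adj-sym (join G₀ G₁ π) {false ∷ u} {false ∷ v} uv = Adj-sym G₀ uv
Adj-sym (join G₀ G₁ π) {true  ∷ u} {true  ∷ v} uv = Adj-sym G₁ uv
Adj-sym (join G₀ G₁ π) {false ∷ u} {true  ∷ v} uv = uv
Adj-sym (join G₀ G₁ π) {true  ∷ u} {false ∷ v} uv = uv

H4-connected : ∀ {n} (G : H4 n) u v → Star (Adj G) u v
H4-connected K4 u v with u ≟V v
... | yes refl = ε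
... | no  u≢v  = u≢v ◅ ε
H4-connected (join G₀ G₁ π) (false ∷ u) (false ∷ v) = gmap (false ∷_) (λ uv → uv) (H4-connected G₀ u v)
H4-connected (join G₀ G₁ π) (true  ∷ u) (true  ∷ v) = gmap (true ∷_) (λ uv → uv) (H4-connected G₁ u v)
H4-connected (join G₀ G₁ π) (false ∷ u) (true  ∷ v) =
  gmap (false ∷_) (λ uv → uv) (H4-connected G₀ u (Inverse.from π v)) ◅◅ (Inverse.strictlyInverseˡ π v ◅ ε)
H4-connected (join G₀ G₁ π) (true  ∷ u) (false ∷ v) =
  gmap (true ∷_) (λ uv → uv) (H4-connected G₁ u (Inverse.to π v)) ◅◅ (refl ◅ ε)

InF? : ∀ {n} (F : EdgeList n) → Decidable (InF F)
InF? F u v = ∈F? (u , v) ⊎-dec ∈F? (v , u)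
  where ∈F? = λ e → _∈?_ (×-≡-dec _≟V_ _≟V_) e F

InF-sym : ∀ {n} {F : EdgeList n} → Symmetric (InF F)
InF-sym = swap

InF-mono : ∀ {n} {F F′ : EdgeList n} → (∀ {e} → e ∈ F → e ∈ F′) → ∀ {u v} → InF F u v → InF F′ u v
InF-mono F⊆F′ (inj₁ uv∈) = inj₁ (F⊆F′ uv∈)
InF-mono F⊆F′ (inj₂ vu∈) = inj₂ (F⊆F′ vu∈)

SameEdge⇒InF : ∀ {n} {F : EdgeList n} {p q u v} → (p , q) ∈ F → SameEdge (u , v) (p , q) → InF F u v
SameEdge⇒InF pq∈ (inj₁ (refl , refl)) = inj₁ pq∈
SameEdge⇒InF pq∈ (inj₂ (refl , refl)) = inj₂ pq∈

module Cuts {n} (G : H4 n) where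

  AdjF? : ∀ F → Decidable (AdjF G F)
  AdjF? F u v = Adj? G u v ×-dec ¬? (InF? F u v)

  AdjF-sym : ∀ {F} → Symmetric (AdjF G F)
  AdjF-sym (uv , uv∉F) = Adj-sym G uv , λ vu∈F → uv∉F (InF-sym vu∈F)

  Conn? : ∀ F → Decidable (Conn G F)
  Conn? F = Reachability.Star? _≟V_ (AdjF? F) (allV n) ∈-allV

  Conn-sym : ∀ {F} → Symmetric (Conn G F)
  Conn-sym = reverse AdjF-sym

  crossingEdge : ∀ F {u s t} → Star (Adj G) s t → Conn G F u s → ¬ Conn G F u t →
                 ∃[ x ] ∃[ y ] (Conn G F u x × ¬ Conn G F u y × Adj G x y)
  crossingEdge F ε us ¬ut = ⊥-elim (¬ut us)
  crossingEdge F {u} {s} (_◅_ {j = s′} ss′ s′t) us ¬ut with Conn? F u s′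
  ... | yes us′ = crossingEdge F s′t us′ ¬ut
  ... | no ¬us′ = s , s′ , us , ¬us′ , ss′

density-merge : ∀ l a b c d → l * a ≤ 2 * c → l * b ≤ 2 * d → l * (a + b) ≤ 2 * (c + (d + 1))
density-merge l a b c d la≤ lb≤ = begin
  l * (a + b)         ≡⟨ *-distribˡ-+ l a b ⟩
  l * a + l * b       ≤⟨ +-mono-≤ la≤ lb≤ ⟩
  2 * c + 2 * d       ≤⟨ +-monoʳ-≤ (2 * c) (*-monoʳ-≤ 2 (m≤m+n d 1)) ⟩
  2 * c + 2 * (d + 1) ≡⟨ sym (*-distribˡ-+ 2 c (d + 1)) ⟩
  2 * (c + (d + 1))   ∎
  where open ≤-Reasoning

module RestoreEdge {n} (G : H4 n) (F : EdgeList n) (isEdgeSet : IsEdgeSet G F)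
                   {p q : V n} (pq∈F : (p , q) ∈ F) (p≁q : ¬ Conn G F p q) where
  open Cuts G

  F⁻ : EdgeList n
  F⁻ = F ─ pq∈F

  length-F⁻ : length F ≡ suc (length F⁻)
  length-F⁻ = length-removeAt′ F (index pq∈F)

  IsEdgeSet-F⁻ : IsEdgeSet G F⁻
  IsEdgeSet-F⁻ = All.─⁺ pq∈F (proj₁ isEdgeSet) , AllPairs-─⁺ pq∈F (proj₂ isEdgeSet)

  InF⁻⇒InF : ∀ {x y} → InF F⁻ x y → InF F x y
  InF⁻⇒InF = InF-mono (∈-─⁻ pq∈F)

  InF⇒InF⁻⊎pq : ∀ {x y} → InF F x y → InF F⁻ x y ⊎ SameEdge (x , y) (p , q)
  InF⇒InF⁻⊎pq (inj₁ xy∈) with ∈-─-cases pq∈F xy∈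
  ... | inj₁ refl = inj₂ (inj₁ (refl , refl))
  ... | inj₂ xy∈⁻ = inj₁ (inj₁ xy∈⁻)
  InF⇒InF⁻⊎pq (inj₂ yx∈) with ∈-─-cases pq∈F yx∈
  ... | inj₁ refl = inj₂ (inj₂ (refl , refl))
  ... | inj₂ yx∈⁻ = inj₁ (inj₂ yx∈⁻)

  -- F contains no edge twice, so {p, q} really leaves.
  pq∉F⁻ : ¬ InF F⁻ p q
  pq∉F⁻ (inj₁ pq∈⁻) with AllPairs-─-removed pq∈F (proj₂ isEdgeSet) pq∈⁻
  ... | inj₁ ¬same = ¬same (inj₁ (refl , refl))
  ... | inj₂ ¬same = ¬same (inj₁ (refl , refl))
  pq∉F⁻ (inj₂ qp∈⁻) with AllPairs-─-removed pq∈F (proj₂ isEdgeSet) qp∈⁻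
  ... | inj₁ ¬same = ¬same (inj₂ (refl , refl))
  ... | inj₂ ¬same = ¬same (inj₂ (refl , refl))

  AdjF⁻-pq : AdjF G F⁻ p q
  AdjF⁻-pq = All.lookup (proj₁ isEdgeSet) pq∈F , pq∉F⁻

  AdjF⇒AdjF⁻ : ∀ {x y} → AdjF G F x y → AdjF G F⁻ x y
  AdjF⇒AdjF⁻ (xy , xy∉F) = xy , λ xy∈F⁻ → xy∉F (InF⁻⇒InF xy∈F⁻)

  AdjF⁻⇒AdjF⊎pq : ∀ {x y} → AdjF G F⁻ x y → AdjF G F x y ⊎ SameEdge (x , y) (p , q)
  AdjF⁻⇒AdjF⊎pq {x} {y} (xy , xy∉F⁻) with InF? F x y
  ... | no xy∉F = inj₁ (xy , xy∉F)
  ... | yes xy∈F with InF⇒InF⁻⊎pq xy∈F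
  ...   | inj₁ xy∈F⁻ = ⊥-elim (xy∉F⁻ xy∈F⁻)
  ...   | inj₂ same  = inj₂ same

  Conn⇒Conn⁻ : ∀ {x y} → Conn G F x y → Conn G F⁻ x y
  Conn⇒Conn⁻ = Star.map AdjF⇒AdjF⁻

  Merged : V n → Set
  Merged z = Conn G F p z ⊎ Conn G F q z

  Merged? : ∀ z → Dec (Merged z)
  Merged? z = Conn? F p z ⊎-dec Conn? F q z

  Merged-Conn : ∀ {x y} → Merged x → Conn G F x y → Merged y
  Merged-Conn (inj₁ px) xy = inj₁ (px ◅◅ xy)
  Merged-Conn (inj₂ qx) xy = inj₂ (qx ◅◅ xy)

  Merged-Conn⁻ : ∀ {x y} → Merged x → Conn G F⁻ x y → Merged y
  Merged-Conn⁻ Mx ε = Mx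
  Merged-Conn⁻ Mx (xz ◅ zy) with AdjF⁻⇒AdjF⊎pq xz
  ... | inj₁ xz′                  = Merged-Conn⁻ (Merged-Conn Mx (xz′ ◅ ε)) zy
  ... | inj₂ (inj₁ (refl , refl)) = Merged-Conn⁻ (inj₂ ε) zy
  ... | inj₂ (inj₂ (refl , refl)) = Merged-Conn⁻ (inj₁ ε) zy

  unmerged-Conn : ∀ {x y} → ¬ Merged x → Conn G F x y → ¬ Merged y
  unmerged-Conn ¬Mx xy My = ¬Mx (Merged-Conn My (Conn-sym xy))

  unmerged-AdjF⁻⇒AdjF : ∀ {x y} → ¬ Merged x → AdjF G F⁻ x y → AdjF G F x y
  unmerged-AdjF⁻⇒AdjF ¬Mx xy with AdjF⁻⇒AdjF⊎pq xy
  ... | inj₁ xy′                  = xy′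
  ... | inj₂ (inj₁ (refl , refl)) = ⊥-elim (¬Mx (inj₁ ε))
  ... | inj₂ (inj₂ (refl , refl)) = ⊥-elim (¬Mx (inj₂ ε))

  unmerged-Conn⁻⇒Conn : ∀ {x y} → ¬ Merged x → Conn G F⁻ x y → Conn G F x y
  unmerged-Conn⁻⇒Conn ¬Mx ε = ε
  unmerged-Conn⁻⇒Conn ¬Mx (xz ◅ zy) =
    xz′ ◅ unmerged-Conn⁻⇒Conn (unmerged-Conn ¬Mx (xz′ ◅ ε)) zy
    where xz′ = unmerged-AdjF⁻⇒AdjF ¬Mx xz

  Merged-connected⁻ : ∀ {x y} → Merged x → Merged y → Conn G F⁻ x y
  Merged-connected⁻ Mx My = Conn-sym (p-Conn⁻ Mx) ◅◅ p-Conn⁻ My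
    where
      p-Conn⁻ : ∀ {z} → Merged z → Conn G F⁻ p z
      p-Conn⁻ (inj₁ pz) = Conn⇒Conn⁻ pz
      p-Conn⁻ (inj₂ qz) = (AdjF⁻-pq ◅ ε) ◅◅ Conn⇒Conn⁻ qz

  separated⁻ : ∀ {a b} → ¬ Conn G F a b → ¬ (Merged a × Merged b) → ¬ Conn G F⁻ a b
  separated⁻ {a} ¬ab ¬MaMb ab with Merged? a
  ... | yes Ma = ¬MaMb (Ma , Merged-Conn⁻ Ma ab)
  ... | no ¬Ma = ¬ab (unmerged-Conn⁻⇒Conn ¬Ma ab)

  CompAtLeast⁻ : ∀ {r k} → CompAtLeast G F r k → CompAtLeast G F⁻ r k
  CompAtLeast⁻ (xs , unique , conn , k≤) = xs , unique , All.map Conn⇒Conn⁻ conn , k≤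

  CompMinDeg⁻ : ∀ {l} → (∀ r → CompMinDeg G F r l) → ∀ r → CompMinDeg G F⁻ r l
  CompMinDeg⁻ minDeg r u _ with minDeg u u ε
  ... | ys , unique , adj , l≤ = ys , unique , All.map AdjF⇒AdjF⁻ adj , l≤

  CompSubnet⁻ : ∀ {l} → (∀ r → CompSubnet G F r l) → ∀ r → CompSubnet G F⁻ r l
  CompSubnet⁻ subnet r u _ e e∈F⁻ = subnet u u ε e (∈-─⁻ pq∈F e∈F⁻)

  CompHasCycle⁻ : ∀ {r} → CompHasCycle G F r → CompHasCycle G F⁻ r
  CompHasCycle⁻ (v , vs , 2≤ , unique , conn , cycle) =
    v , vs , 2≤ , unique , All.map Conn⇒Conn⁻ conn , Linked.map AdjF⇒AdjF⁻ cycle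

  AdjF⇒¬SameEdge-pq : ∀ {x y} → AdjF G F x y → ¬ SameEdge (x , y) (p , q)
  AdjF⇒¬SameEdge-pq (_ , xy∉F) same = xy∉F (SameEdge⇒InF pq∈F same)

  ¬SameEdge-across : ∀ {x y x′ y′} → Conn G F p x → AdjF G F x′ y′ → Conn G F q x′ →
                     ¬ SameEdge (x , y) (x′ , y′)
  ¬SameEdge-across px _     qx′ (inj₁ (refl , _))    = p≁q (px ◅◅ Conn-sym qx′)
  ¬SameEdge-across px x′y′ qx′ (inj₂ (refl , _)) = p≁q (px ◅◅ Conn-sym (qx′ ◅◅ (x′y′ ◅ ε)))

  CompAvgDeg-unmerged : ∀ {r l} → ¬ Merged r → CompAvgDeg G F r l → CompAvgDeg G F⁻ r l
  CompAvgDeg-unmerged {r} ¬Mr (xs , es , (unique , cover , conn) , (edges , distinct , closed) , l≤) =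
    xs , es , (unique , (λ v rv → cover v (back rv)) , All.map Conn⇒Conn⁻ conn)
    , ( All.map (λ (xy , rx) → AdjF⇒AdjF⁻ xy , Conn⇒Conn⁻ rx) edges , distinct
      , λ a b ra ab → closed a b (back ra) (unmerged-AdjF⁻⇒AdjF (unmerged-Conn ¬Mr (back ra)) ab))
    , l≤
    where
      back : ∀ {v} → Conn G F⁻ r v → Conn G F r v
      back = unmerged-Conn⁻⇒Conn ¬Mr

  CompAvgDeg-merged : ∀ {r l} → Merged r → CompAvgDeg G F p l → CompAvgDeg G F q l → CompAvgDeg G F⁻ r l
  CompAvgDeg-merged {r} {l} Mr
      (xs₁ , es₁ , (unique₁ , cover₁ , conn₁) , (edges₁ , distinct₁ , closed₁) , l≤₁)
      (xs₂ , es₂ , (unique₂ , cover₂ , conn₂) , (edges₂ , distinct₂ , closed₂) , l≤₂) =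
    xs₁ ++ xs₂ , es
    , ( Unique.++⁺ unique₁ unique₂ (λ (v∈₁ , v∈₂) → p≁q (All.lookup conn₁ v∈₁ ◅◅ Conn-sym (All.lookup conn₂ v∈₂)))
      , cover
      , All.++⁺ (All.map (λ pv → Merged-connected⁻ Mr (inj₁ pv)) conn₁)
                (All.map (λ qv → Merged-connected⁻ Mr (inj₂ qv)) conn₂) )
    , ( All.++⁺ (All.map (λ (xy , px) → AdjF⇒AdjF⁻ xy , Merged-connected⁻ Mr (inj₁ px)) edges₁)
                (All.++⁺ (All.map (λ (xy , qx) → AdjF⇒AdjF⁻ xy , Merged-connected⁻ Mr (inj₂ qx)) edges₂)
                         ((AdjF⁻-pq , Merged-connected⁻ Mr (inj₁ ε)) ∷ []))
      , AllPairs.++⁺ distinct₁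
          (AllPairs.++⁺ distinct₂ ([] ∷ []) (All.map (λ (xy , _) → AdjF⇒¬SameEdge-pq xy ∷ []) edges₂))
          (All.map (λ (xy , px) → All.++⁺ (All.map (λ (x′y′ , qx′) → ¬SameEdge-across px x′y′ qx′) edges₂)
                                          (AdjF⇒¬SameEdge-pq xy ∷ []))
                   edges₁)
      , closed )
    , l≤
    where
      es : EdgeList n
      es = es₁ ++ (es₂ ++ [ (p , q) ])

      cover : ∀ v → Conn G F⁻ r v → v ∈ xs₁ ++ xs₂
      cover v rv with Merged-Conn⁻ Mr rv
      ... | inj₁ pv = ∈-++⁺ˡ (cover₁ v pv)
      ... | inj₂ qv = ∈-++⁺ʳ xs₁ (cover₂ v qv)

      closed : ∀ a b → Conn G F⁻ r a → AdjF G F⁻ a b → InF es a b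
      closed a b ra ab with Merged-Conn⁻ Mr ra | AdjF⁻⇒AdjF⊎pq ab
      ... | inj₁ pa | inj₁ ab′  = InF-mono ∈-++⁺ˡ (closed₁ a b pa ab′)
      ... | inj₂ qa | inj₁ ab′  = InF-mono (λ e∈ → ∈-++⁺ʳ es₁ (∈-++⁺ˡ e∈)) (closed₂ a b qa ab′)
      ... | _       | inj₂ same = SameEdge⇒InF (∈-++⁺ʳ es₁ (∈-++⁺ʳ es₂ (here refl))) same

      l≤ : l * length (xs₁ ++ xs₂) ≤ 2 * length es
      l≤ rewrite length-++ xs₁ {xs₂} | length-++ es₁ {es₂ ++ [ (p , q) ]} | length-++ es₂ {[ (p , q) ]} =
        density-merge l (length xs₁) (length xs₂) (length es₁) (length es₂) l≤₁ l≤₂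

  CompAvgDeg⁻ : ∀ {l} → (∀ r → CompAvgDeg G F r l) → ∀ r → CompAvgDeg G F⁻ r l
  CompAvgDeg⁻ {l} avgDeg r with Merged? r
  ... | yes Mr  = CompAvgDeg-merged {l = l} Mr (avgDeg p) (avgDeg q)
  ... | no ¬Mr = CompAvgDeg-unmerged {l = l} ¬Mr (avgDeg r)

  Disconnected-F⁻ : ∀ {a b} → ¬ Conn G F a b → ¬ (Merged a × Merged b) → Disconnected G F⁻
  Disconnected-F⁻ {a} {b} ¬ab ¬MaMb = a , b , separated⁻ ¬ab ¬MaMb

minimum⇒exactlyTwoComponents :
  ∀ {n} (G : H4 n) (F : EdgeList n) (isEdgeSet : IsEdgeSet G F) (Q : EdgeList n → Set) →
  (∀ F′ → IsEdgeSet G F′ × Disconnected G F′ × Q F′ → length F ≤ length F′) →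
  ∀ {a b} → ¬ Conn G F a b →
  (∀ {p q} (pq∈F : (p , q) ∈ F) (p≁q : ¬ Conn G F p q) →
     let open RestoreEdge G F isEdgeSet pq∈F p≁q in ¬ (Merged a × Merged b) → Q F⁻) →
  ExactlyTwoComponents G F
minimum⇒exactlyTwoComponents G F isEdgeSet Q minimal {a} {b} ¬ab restore = a , b , ¬ab , classify
  where
    open Cuts G

    restore-⊥ : ∀ {p q} (pq∈F : (p , q) ∈ F) (p≁q : ¬ Conn G F p q) →
                ¬ ((Conn G F p a ⊎ Conn G F q a) × (Conn G F p b ⊎ Conn G F q b)) → ⊥
    restore-⊥ pq∈F p≁q ¬MaMb = n≮n _ (subst (_≤ length F⁻) length-F⁻ (minimal F⁻ cut⁻))
      where
        open RestoreEdge G F isEdgeSet pq∈F p≁q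
        cut⁻ : IsEdgeSet G F⁻ × Disconnected G F⁻ × Q F⁻
        cut⁻ = IsEdgeSet-F⁻ , Disconnected-F⁻ ¬ab ¬MaMb , restore pq∈F p≁q ¬MaMb

    notBoth : ∀ {u x y} → ¬ Conn G F a u → ¬ Conn G F b u → Conn G F u x →
              ¬ ((Conn G F x a ⊎ Conn G F y a) × (Conn G F x b ⊎ Conn G F y b))
    notBoth ¬au _   ux (inj₁ xa , _)       = ¬au (Conn-sym (ux ◅◅ xa))
    notBoth _   ¬bu ux (_ , inj₁ xb)       = ¬bu (Conn-sym (ux ◅◅ xb))
    notBoth _   _   _  (inj₂ ya , inj₂ yb) = ¬ab (Conn-sym ya ◅◅ yb)

    thirdComponent-⊥ : ∀ {u} → ¬ Conn G F a u → ¬ Conn G F b u → ⊥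
    thirdComponent-⊥ {u} ¬au ¬bu with crossingEdge F (H4-connected G u a) ε (λ ua → ¬au (Conn-sym ua))
    ... | x , y , ux , ¬uy , xy with InF? F x y
    ...   | no xy∉F         = ¬uy (ux ◅◅ ((xy , xy∉F) ◅ ε))
    ...   | yes (inj₁ xy∈F) = restore-⊥ xy∈F (λ x~y → ¬uy (ux ◅◅ x~y)) (notBoth ¬au ¬bu ux)
    ...   | yes (inj₂ yx∈F) = restore-⊥ yx∈F (λ y~x → ¬uy (ux ◅◅ Conn-sym y~x))
                                (λ (Ma , Mb) → notBoth ¬au ¬bu ux (swap Ma , swap Mb))

    classify : ∀ u → Conn G F a u ⊎ Conn G F b u
    classify u with Conn? F a u | Conn? F b u
    ... | yes au | _      = inj₁ au
    ... | no _   | yes bu = inj₂ bu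
    ... | no ¬au | no ¬bu = ⊥-elim (thirdComponent-⊥ ¬au ¬bu)

lemma2p4 : (n : ℕ) → 3 ≤ n → (l : ℕ) → 2 ≤ l → l < n → (h : ℕ) → 1 ≤ h →
    (G : H4 n) → (F : EdgeList n) →
    (IsMinimum (ExtraCut h G) F ⊎ Σ Property (λ P → IsMinimum (CondCut P l G) F)) →
    ExactlyTwoComponents G F
lemma2p4 n _ l _ _ h _ G F (inj₁ ((isEdgeSet , (_ , _ , ¬ab) , atLeast) , minimal)) =
  minimum⇒exactlyTwoComponents G F isEdgeSet _ minimal ¬ab λ pq∈F p≁q _ r →
    RestoreEdge.CompAtLeast⁻ G F isEdgeSet pq∈F p≁q (atLeast r)
lemma2p4 n _ l _ _ h _ G F (inj₂ (𝓟₁ , (isEdgeSet , (_ , _ , ¬ab) , minDeg) , minimal)) =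
  minimum⇒exactlyTwoComponents G F isEdgeSet _ minimal ¬ab λ pq∈F p≁q _ →
    RestoreEdge.CompMinDeg⁻ G F isEdgeSet pq∈F p≁q minDeg
lemma2p4 n _ l _ _ h _ G F (inj₂ (𝓟₂ , (isEdgeSet , (_ , _ , ¬ab) , avgDeg) , minimal)) =
  minimum⇒exactlyTwoComponents G F isEdgeSet _ minimal ¬ab λ pq∈F p≁q _ →
    RestoreEdge.CompAvgDeg⁻ G F isEdgeSet pq∈F p≁q {l} avgDeg
lemma2p4 n _ l _ _ h _ G F (inj₂ (𝓟₃ , (isEdgeSet , (_ , _ , ¬ab) , atLeast) , minimal)) =
  minimum⇒exactlyTwoComponents G F isEdgeSet _ minimal ¬ab λ pq∈F p≁q _ r →
    RestoreEdge.CompAtLeast⁻ G F isEdgeSet pq∈F p≁q (atLeast r)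
lemma2p4 n _ l _ _ h _ G F (inj₂ (𝓟₄ , (isEdgeSet , (_ , _ , ¬ab) , subnet) , minimal)) =
  minimum⇒exactlyTwoComponents G F isEdgeSet _ minimal ¬ab λ pq∈F p≁q _ →
    RestoreEdge.CompSubnet⁻ G F isEdgeSet pq∈F p≁q {l} subnet
lemma2p4 n _ l _ _ h _ G F (inj₂ (𝓟₅ , (isEdgeSet , _ , (a , b , ¬ab , cycleᵃ , cycleᵇ)) , minimal)) =
  minimum⇒exactlyTwoComponents G F isEdgeSet _ minimal ¬ab λ pq∈F p≁q ¬MaMb →
    let open RestoreEdge G F isEdgeSet pq∈F p≁q in
    a , b , separated⁻ ¬ab ¬MaMb , CompHasCycle⁻ cycleᵃ , CompHasCycle⁻ cycleᵇ
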